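{- Let $u,v\in X^*$ be words, let $I_1,J_1$ be disjoint with $I_1\cup J_1=[1\dots|u|]$, and let $I_2,J_2$ be disjoint with $I_2\cup J_2=[|u|+1\dots|u|+|v|]$. Then $$pack\Big((u*v)[J_1\cup J_2]\big/(u*v)[I_1\cup I_2]\Big)=pack\big(u[J_1]/u[I_1]\big)*pack\big(v[J_2']/v[I_2']\big),$$ where $I_2'=\{k-|u|:k\in I_2\}$ and $J_2'=\{k-|u|:k\in J_2\}$.
   Context: $X=\{x_i\}_{i\ge 0}$ is an alphabet totally ordered by index, $X^*$ the free monoid of words over $X$. For a word $w$, $|w|$ is its length, $w[i]$ its $i$-th letter, $IAlph(w)=\{i\in\mathbb N: x_i\text{ occurs in }w\}$, $Alph(w)=\{x_i: i\in IAlph(w)\}$, $sup(w)$ the supremum of $IAlph(w)$ in $\mathbb N$ (with $sup$ of the empty word equal to $0$). For $\phi$ on $IAlph(w)$ with values in $\mathbb N$ and $\phi(0)=0$, $S_\phi(x_{i_1}\cdots x_{i_m})=x_{\phi(i_1)}\cdots x_{\phi(i_m)}$. If $IAlph(w)\setminus\{0\}=\{j_1<\dots<j_k\}$, let $\phi_w(j_m)=m$, $\phi_w(0)=0$ and $pack(w)=S_{\phi_w}(w)$. For $t\in\mathbb N$, $T_t(w)=S_\phi(w)$ with $\phi(n)=n+t$ for $n>0$, $\phi(0)=0$. Shifted concatenation: $u*v=u\,T_{sup(u)}(v)$. For $I=\{i_1<\dots<i_l\}\subseteq[1\dots|w|]$, $w[I]=w[i_1]\cdots w[i_l]$. For $A\subseteq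 X$, $w/A=S_{\phi_A}(w)$ with $\phi_A(i)=0$ if $x_i\in A$, $\phi_A(i)=i$ otherwise; for words $w,u$, $w/u:=w/Alph(u)$. -}

module Defs where

open import Data.Nat using (ℕ; zero; suc; _+_; _⊔_; _≤_; _≤ᵇ_)
open import Data.Nat.Properties using (_≟_)
open import Data.Bool using (Bool; true; false; if_then_else_; _∧_)
open import Data.List using (List; []; _∷_; _++_; map; length; foldr; filter; upTo)
open import Data.List.Membership.DecPropositional _≟_ using (_∈?_)
open import Relation.Nullary.Decidable using (does; ⌊_⌋)

-- A word over X = {x_i} is a list of indices: the letter x_i is represented by i.
Word : Set
Word = List ℕ

-- Index sets of positions (1-based) are given by characteristic functions ℕ → Bool.
IndexSet : Set
IndexSet = ℕ → Bool

sup : Word → ℕ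
sup = foldr _⊔_ 0

subst-letters : (ℕ → ℕ) → Word → Word
subst-letters φ = map φ

T : ℕ → Word → Word
T t = subst-letters (λ { zero → zero ; (suc n) → suc n + t })

_⊛_ : Word → Word → Word
u ⊛ v = u ++ T (sup u) v

occurs : ℕ → Word → Bool
occurs i w = does (i ∈? w)

-- φ_w(j) = #{ k ∈ IAlph(w)∖{0} : k ≤ j } (so φ_w(j_m) = m), φ_w(0) = 0.
φ-pack : Word → ℕ → ℕ
φ-pack w zero = zero
φ-pack w (suc j) = (if occurs (suc j) w then 1 else 0) + φ-pack w j

pack : Word → Word
pack w = subst-letters (φ-pack w) w

-- w / A for A = Alph(u):  letters of Alph(u) are sent to x_0, others fixed.
_/_ : Word → Word → Word
w / u = subst-letters (λ i → if occurs i u then 0 else i) w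

restrictFrom : ℕ → Word → IndexSet → Word
restrictFrom p [] I = []
restrictFrom p (a ∷ w) I = if I p then a ∷ restrictFrom (suc p) w I else restrictFrom (suc p) w I

_[_] : Word → IndexSet → Word
w [ I ] = restrictFrom 1 w I

_∪ᵢ_ : IndexSet → IndexSet → IndexSet
(I ∪ᵢ J) k = if I k then true else J k

-- I' = { k - t : k ∈ I } (for I ⊆ [t+1 …], as used in the statement)
shiftDown : ℕ → IndexSet → IndexSet
shiftDown t I k = I (k + t)

-- Write s = sup u.  Every letter of u is ≤ s, whereas the nonzero letters of
-- T_s(v) are > s; so in u * v = u T_s(v) the two factors use disjoint parts of
-- the alphabet.  The proof exploits this in three steps, each a general fact
-- about words of the form A T_s(B) with all letters of A bounded by s:
--   1. restriction: (u * v)[I₁ ∪ I₂] = u[I₁] T_s(v[I₂']) when I₁ only selects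
--      positions of u and I₂ only positions of v   (restrict-⊛);
--   2. quotient:    (A T_s(B)) / (C T_s(D)) = (A / C) T_s(B / D)    (/-split);
--   3. packing:     pack (A T_s(B)) = pack A * pack B              (pack-split).
-- Steps 2 and 3 are both instances of one observation (map-split): a letter
-- substitution acts factorwise on A T_s(B) as soon as it does so letterwise,
-- which reduces them to statements about single letters and their occurrences.

module Submission where

open import Defs
open import Data.Nat using (ℕ; zero; suc; _+_; _⊔_; _≤_; _<_; _≤′_; ≤′-refl; ≤′-step; z≤n; s≤s)
open import Data.Nat.Properties
open import Data.Bool using (true; false; if_then_else_; _∨_)
open import Data.Bool.Properties using (∨-assoc; ∨-identityʳ; if-eta; if-float)
open import Data.List using ([]; _∷_; _++_; map; length)
open import Data.List.Properties using (map-++; map-∘; map-cong-local)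
open import Data.List.Membership.Propositional using (_∈_; _∉_)
open import Data.List.Membership.Propositional.Properties using (∈-map⁺; ∈-map⁻)
open import Data.List.Membership.DecPropositional _≟_ using (_∈?_)
open import Data.List.Relation.Unary.All as All using (All; []; _∷_)
open import Data.Product using (_×_; _,_; proj₁; proj₂)
open import Data.Sum using (_⊎_; inj₁; inj₂)
open import Data.Empty using (⊥-elim)
open import Function using (_∘_)
open import Function.Bundles using (_⇔_; Equivalence)
open import Relation.Nullary using (¬_; does)
open import Relation.Nullary.Decidable using (dec-true; dec-false; does-≡; map′)
open import Relation.Binary.PropositionalEquality
  using (_≡_; refl; sym; trans; cong; cong₂; subst; module ≡-Reasoning)

open ≡-Reasoning

-- Restriction of a word to a set of positions

restrict-++ : ∀ p (w w′ : Word) (I : IndexSet) →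
  restrictFrom p (w ++ w′) I ≡ restrictFrom p w I ++ restrictFrom (p + length w) w′ I
restrict-++ p [] w′ I rewrite +-identityʳ p = refl
restrict-++ p (a ∷ w) w′ I rewrite +-suc p (length w) with I p
... | true  = cong (a ∷_) (restrict-++ (suc p) w w′ I)
... | false = restrict-++ (suc p) w w′ I

-- Restriction only selects positions, so it commutes with letter substitutions.
restrict-map : ∀ p (f : ℕ → ℕ) (w : Word) (I : IndexSet) →
  restrictFrom p (map f w) I ≡ map f (restrictFrom p w I)
restrict-map p f [] I = refl
restrict-map p f (a ∷ w) I with I p
... | true  = cong (f a ∷_) (restrict-map (suc p) f w I)
... | false = restrict-map (suc p) f w I

restrict-cong : ∀ p (w : Word) (I I′ : IndexSet) →
  (∀ k → p ≤ k → k < p + length w → I k ≡ I′ k) →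
  restrictFrom p w I ≡ restrictFrom p w I′
restrict-cong p [] I I′ agree = refl
restrict-cong p (a ∷ w) I I′ agree =
  cong₂ (λ b r → if b then a ∷ r else r)
        (agree p ≤-refl (m<m+n p (s≤s z≤n)))
        (restrict-cong (suc p) w I I′ agree′)
  where
  agree′ : ∀ k → suc p ≤ k → k < suc p + length w → I k ≡ I′ k
  agree′ k p<k k<end = agree k (<⇒≤ p<k) (subst (k <_) (sym (+-suc p (length w))) k<end)

restrict-shift : ∀ p t (w : Word) (I : IndexSet) →
  restrictFrom (p + t) w I ≡ restrictFrom p w (shiftDown t I)
restrict-shift p t [] I = refl
restrict-shift p t (a ∷ w) I with I (p + t)
... | true  = cong (a ∷_) (restrict-shift (suc p) t w I)
... | false = restrict-shift (suc p) t w I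

-- A restriction is a subword, so it inherits every letterwise property.
restrict-All : ∀ {P : ℕ → Set} p (w : Word) (I : IndexSet) → All P w → All P (restrictFrom p w I)
restrict-All p [] I [] = []
restrict-All p (a ∷ w) I (pa ∷ pw) with I p
... | true  = pa ∷ restrict-All (suc p) w I pw
... | false = restrict-All (suc p) w I pw

restrict-⊛ : ∀ (u v : Word) (I₁ I₂ : IndexSet) →
  (∀ k → I₁ k ≡ true → k ≤ length u) →
  (∀ k → I₂ k ≡ true → length u + 1 ≤ k) →
  (u ⊛ v) [ I₁ ∪ᵢ I₂ ] ≡ (u [ I₁ ]) ++ T (sup u) (v [ shiftDown (length u) I₂ ])
restrict-⊛ u v I₁ I₂ I₁⊆u I₂⊆v = begin
  restrictFrom 1 (u ++ T (sup u) v) (I₁ ∪ᵢ I₂)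
    ≡⟨ restrict-++ 1 u (T (sup u) v) (I₁ ∪ᵢ I₂) ⟩
  restrictFrom 1 u (I₁ ∪ᵢ I₂) ++ restrictFrom (1 + length u) (T (sup u) v) (I₁ ∪ᵢ I₂)
    ≡⟨ cong₂ _++_ (restrict-cong 1 u _ _ onlyI₁) (restrict-map (1 + length u) _ v _) ⟩
  (u [ I₁ ]) ++ T (sup u) (restrictFrom (1 + length u) v (I₁ ∪ᵢ I₂))
    ≡⟨ cong (λ x → (u [ I₁ ]) ++ T (sup u) x) (restrict-cong (1 + length u) v _ _ onlyI₂) ⟩
  (u [ I₁ ]) ++ T (sup u) (restrictFrom (1 + length u) v I₂)
    ≡⟨ cong (λ x → (u [ I₁ ]) ++ T (sup u) x) (restrict-shift 1 (length u) v I₂) ⟩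
  (u [ I₁ ]) ++ T (sup u) (v [ shiftDown (length u) I₂ ]) ∎
  where
  onlyI₁ : ∀ k → 1 ≤ k → k < 1 + length u → (I₁ ∪ᵢ I₂) k ≡ I₁ k
  onlyI₁ k _ k≤u with I₁ k | I₂ k in k∈I₂
  ... | true  | _     = refl
  ... | false | false = refl
  ... | false | true  = ⊥-elim (<⇒≱ k≤u (subst (_≤ k) (+-comm (length u) 1) (I₂⊆v k k∈I₂)))
  onlyI₂ : ∀ k → 1 + length u ≤ k → k < 1 + length u + length v → (I₁ ∪ᵢ I₂) k ≡ I₂ k
  onlyI₂ k u<k _ with I₁ k in k∈I₁
  ... | false = refl
  ... | true  = ⊥-elim (<⇒≱ u<k (I₁⊆u k k∈I₁))

-- Letter occurrences

≤-sup : ∀ (w : Word) → All (_≤ sup w) w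
≤-sup [] = []
≤-sup (a ∷ w) = m≤m⊔n a (sup w) ∷ All.map (λ x≤ → ≤-trans x≤ (m≤n⊔m a (sup w))) (≤-sup w)

sup-≤ : ∀ {s} (w : Word) → All (_≤ s) w → sup w ≤ s
sup-≤ [] [] = z≤n
sup-≤ (a ∷ w) (a≤s ∷ w≤s) = ⊔-lub a≤s (sup-≤ w w≤s)

occurs-++ : ∀ i (w w′ : Word) → occurs i (w ++ w′) ≡ occurs i w ∨ occurs i w′
occurs-++ i [] w′ = refl
occurs-++ i (a ∷ w) w′ =
  trans (cong (does (i ≟ a) ∨_) (occurs-++ i w w′)) (sym (∨-assoc (does (i ≟ a)) _ _))

occurs-above : ∀ {s i} (w : Word) → All (_≤ s) w → s < i → occurs i w ≡ false
occurs-above {s} {i} w w≤s s<i = dec-false (i ∈? w) λ i∈w → <⇒≱ s<i (All.lookup w≤s i∈w)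

shift : ℕ → ℕ → ℕ
shift t zero = zero
shift t (suc n) = suc n + t

T≡map-shift : ∀ t (w : Word) → T t w ≡ map (shift t) w
T≡map-shift t [] = refl
T≡map-shift t (zero ∷ w) = cong (zero ∷_) (T≡map-shift t w)
T≡map-shift t (suc n ∷ w) = cong (suc n + t ∷_) (T≡map-shift t w)

occurs-T-low : ∀ {s} i (w : Word) → suc i ≤ s → occurs (suc i) (T s w) ≡ false
occurs-T-low {s} i w i<s rewrite T≡map-shift s w = dec-false (suc i ∈? map (shift s) w) absent
  where
  absent : suc i ∉ map (shift s) w
  absent i∈ with ∈-map⁻ (shift s) i∈
  ... | suc x , _ , eq = <⇒≱ (m<n+m s (s≤s z≤n)) (subst (_≤ s) eq i<s)

occurs-T-high : ∀ {s} n (w : Word) → occurs (suc n + s) (T s w) ≡ occurs (suc n) w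
occurs-T-high {s} n w rewrite T≡map-shift s w =
  does-≡ (suc n + s ∈? map (shift s) w) (map′ (∈-map⁺ (shift s)) unshift (suc n ∈? w))
  where
  unshift : suc n + s ∈ map (shift s) w → suc n ∈ w
  unshift n+s∈ with ∈-map⁻ (shift s) n+s∈
  ... | suc x , x∈w , eq = subst (_∈ w) (sym (+-cancelʳ-≡ s (suc n) (suc x) eq)) x∈w

occurs-split-low : ∀ {s} i (A B : Word) → suc i ≤ s → occurs (suc i) (A ++ T s B) ≡ occurs (suc i) A
occurs-split-low i A B i<s =
  trans (occurs-++ (suc i) A _) (trans (cong (_ ∨_) (occurs-T-low i B i<s)) (∨-identityʳ _))

occurs-split-high : ∀ {s} n (A B : Word) → All (_≤ s) A → occurs (suc n + s) (A ++ T s B) ≡ occurs (suc n) B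
occurs-split-high {s} n A B A≤s =
  trans (occurs-++ (suc n + s) A _) (cong₂ _∨_ (occurs-above A A≤s (s≤s (m≤n+m s n))) (occurs-T-high n B))

map-split : ∀ (g f h : ℕ → ℕ) s t (A B : Word) →
  All (λ x → g x ≡ f x) A →
  All (λ x → g (shift s x) ≡ shift t (h x)) B →
  map g (A ++ T s B) ≡ map f A ++ T t (map h B)
map-split g f h s t A B onA onB = begin
  map g (A ++ T s B)              ≡⟨ map-++ g A (T s B) ⟩
  map g A ++ map g (T s B)        ≡⟨ cong₂ _++_ (map-cong-local onA) shifted ⟩
  map f A ++ T t (map h B)        ∎
  where
  shifted : map g (T s B) ≡ T t (map h B)
  shifted = begin
    map g (T s B)                 ≡⟨ cong (map g) (T≡map-shift s B) ⟩
    map g (map (shift s) B)       ≡⟨ map-∘ B ⟨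
    map (g ∘ shift s) B           ≡⟨ map-cong-local onB ⟩
    map (shift t ∘ h) B           ≡⟨ map-∘ B ⟩
    map (shift t) (map h B)       ≡⟨ T≡map-shift t (map h B) ⟨
    T t (map h B)                 ∎

-- Quotients

erase : Word → ℕ → ℕ
erase u i = if occurs i u then 0 else i

erase-≤ : ∀ (u : Word) x → erase u x ≤ x
erase-≤ u x with occurs x u
... | true  = z≤n
... | false = ≤-refl

/-≤ : ∀ {s} (w u : Word) → All (_≤ s) w → All (_≤ s) (w / u)
/-≤ [] u [] = []
/-≤ (a ∷ w) u (a≤s ∷ w≤s) = ≤-trans (erase-≤ u a) a≤s ∷ /-≤ w u w≤s

erase-low : ∀ s (C D : Word) x → x ≤ s → erase (C ++ T s D) x ≡ erase C x
erase-low s C D zero x≤s = trans (if-eta (occurs 0 (C ++ T s D))) (sym (if-eta (occurs 0 C)))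
erase-low s C D (suc i) i<s = cong (λ b → if b then 0 else suc i) (occurs-split-low i C D i<s)

erase-high : ∀ s (C D : Word) → All (_≤ s) C → ∀ x → erase (C ++ T s D) (shift s x) ≡ shift s (erase D x)
erase-high s C D C≤s zero =
  trans (if-eta (occurs 0 (C ++ T s D))) (cong (shift s) (sym (if-eta (occurs 0 D))))
erase-high s C D C≤s (suc n) = begin
  (if occurs (suc n + s) (C ++ T s D) then 0 else suc n + s)
    ≡⟨ cong (λ b → if b then 0 else suc n + s) (occurs-split-high n C D C≤s) ⟩
  (if occurs (suc n) D then 0 else suc n + s)
    ≡⟨ if-float (shift s) (occurs (suc n) D) ⟨
  shift s (erase D (suc n)) ∎

/-split : ∀ s (A B C D : Word) → All (_≤ s) A → All (_≤ s) C →
  (A ++ T s B) / (C ++ T s D) ≡ (A / C) ++ T s (B / D)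
/-split s A B C D A≤s C≤s =
  map-split (erase (C ++ T s D)) (erase C) (erase D) s s A B
    (All.map (λ {x} → erase-low s C D x) A≤s)
    (All.tabulate (λ {x} _ → erase-high s C D C≤s x))

-- Packing

-- φ_w counts letters, so it is monotone.
φ-mono : ∀ (w : Word) {m n} → m ≤ n → φ-pack w m ≤ φ-pack w n
φ-mono w m≤n = go (≤⇒≤′ m≤n)
  where
  go : ∀ {m n} → m ≤′ n → φ-pack w m ≤ φ-pack w n
  go ≤′-refl = ≤-refl
  go (≤′-step m≤n) = ≤-trans (go m≤n) (m≤n+m _ _)

φ-flat : ∀ {s t} (w : Word) → All (_≤ s) w → s ≤′ t → φ-pack w t ≡ φ-pack w s
φ-flat w w≤s ≤′-refl = refl
φ-flat w w≤s (≤′-step {n} s≤n) rewrite occurs-above w w≤s (s≤s (≤′⇒≤ s≤n)) = φ-flat w w≤s s≤n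

sup-map : ∀ (f : ℕ → ℕ) → (∀ {m n} → m ≤ n → f m ≤ f n) → f 0 ≡ 0 →
  ∀ (w : Word) → sup (map f w) ≡ f (sup w)
sup-map f mono f0≡0 [] = sym f0≡0
sup-map f mono f0≡0 (a ∷ w) =
  trans (cong (f a ⊔_) (sup-map f mono f0≡0 w)) (sym (mono-≤-distrib-⊔ mono a (sup w)))

-- The packed word has as many distinct nonzero letters as w: sup (pack w) = φ_w(s).
sup-pack : ∀ {s} (w : Word) → All (_≤ s) w → sup (pack w) ≡ φ-pack w s
sup-pack {s} w w≤s = begin
  sup (map (φ-pack w) w)   ≡⟨ sup-map (φ-pack w) (φ-mono w) refl w ⟩
  φ-pack w (sup w)         ≡⟨ φ-flat w (≤-sup w) (≤⇒≤′ (sup-≤ w w≤s)) ⟨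
  φ-pack w s               ∎

φ-low : ∀ s (A B : Word) x → x ≤ s → φ-pack (A ++ T s B) x ≡ φ-pack A x
φ-low s A B zero x≤s = refl
φ-low s A B (suc i) i<s =
  cong₂ (λ b r → (if b then 1 else 0) + r) (occurs-split-low i A B i<s) (φ-low s A B i (<⇒≤ i<s))

φ-high : ∀ s (A B : Word) → All (_≤ s) A → ∀ k → φ-pack (A ++ T s B) (k + s) ≡ φ-pack B k + φ-pack A s
φ-high s A B A≤s zero = φ-low s A B s ≤-refl
φ-high s A B A≤s (suc k) = begin
  (if occurs (suc k + s) (A ++ T s B) then 1 else 0) + φ-pack (A ++ T s B) (k + s)
    ≡⟨ cong₂ (λ b r → (if b then 1 else 0) + r) (occurs-split-high k A B A≤s) (φ-high s A B A≤s k) ⟩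
  (if occurs (suc k) B then 1 else 0) + (φ-pack B k + φ-pack A s)
    ≡⟨ +-assoc (if occurs (suc k) B then 1 else 0) _ _ ⟨
  φ-pack B (suc k) + φ-pack A s ∎

pack-split : ∀ s (A B : Word) → All (_≤ s) A → pack (A ++ T s B) ≡ pack A ⊛ pack B
pack-split s A B A≤s =
  map-split (φ-pack (A ++ T s B)) (φ-pack A) (φ-pack B) s (sup (pack A)) A B
    (All.map (λ {x} → φ-low s A B x) A≤s)
    (All.tabulate (λ {x} → shifted x))
  where
  shifted : ∀ x → x ∈ B → φ-pack (A ++ T s B) (shift s x) ≡ shift (sup (pack A)) (φ-pack B x)
  shifted zero _ = refl
  shifted (suc n) n∈B = begin
    φ-pack (A ++ T s B) (suc n + s)
      ≡⟨ φ-high s A B A≤s (suc n) ⟩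
    φ-pack B (suc n) + φ-pack A s
      ≡⟨ cong₂ _+_ counted (sym (sup-pack A A≤s)) ⟩
    suc (φ-pack B n) + sup (pack A)
      ≡⟨ cong (shift (sup (pack A))) counted ⟨
    shift (sup (pack A)) (φ-pack B (suc n)) ∎
    where
    counted : φ-pack B (suc n) ≡ suc (φ-pack B n)
    counted = cong (λ b → (if b then 1 else 0) + φ-pack B n) (dec-true (suc n ∈? B) n∈B)

mainTheorem11 : (u v : Word) (I₁ J₁ I₂ J₂ : IndexSet) →
    (∀ k → ¬ (I₁ k ≡ true × J₁ k ≡ true)) →
    (∀ k → (I₁ k ≡ true ⊎ J₁ k ≡ true) ⇔ (1 ≤ k × k ≤ length u)) →
    (∀ k → ¬ (I₂ k ≡ true × J₂ k ≡ true)) →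
    (∀ k → (I₂ k ≡ true ⊎ J₂ k ≡ true) ⇔ (length u + 1 ≤ k × k ≤ length u + length v)) →
    pack (((u ⊛ v) [ J₁ ∪ᵢ J₂ ]) / ((u ⊛ v) [ I₁ ∪ᵢ I₂ ]))
      ≡ pack ((u [ J₁ ]) / (u [ I₁ ]))
        ⊛ pack ((v [ shiftDown (length u) J₂ ]) / (v [ shiftDown (length u) I₂ ]))
mainTheorem11 u v I₁ J₁ I₂ J₂ _ cover₁ _ cover₂ = begin
  pack (((u ⊛ v) [ J₁ ∪ᵢ J₂ ]) / ((u ⊛ v) [ I₁ ∪ᵢ I₂ ]))
    ≡⟨ cong₂ (λ x y → pack (x / y))
             (restrict-⊛ u v J₁ J₂ (inU inj₂) (inV inj₂))
             (restrict-⊛ u v I₁ I₂ (inU inj₁) (inV inj₁)) ⟩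
  pack ((u[J₁] ++ T s v[J₂′]) / (u[I₁] ++ T s v[I₂′]))
    ≡⟨ cong pack (/-split s u[J₁] v[J₂′] u[I₁] v[I₂′] (≤s J₁) (≤s I₁)) ⟩
  pack ((u[J₁] / u[I₁]) ++ T s (v[J₂′] / v[I₂′]))
    ≡⟨ pack-split s (u[J₁] / u[I₁]) (v[J₂′] / v[I₂′]) (/-≤ u[J₁] u[I₁] (≤s J₁)) ⟩
  pack (u[J₁] / u[I₁]) ⊛ pack (v[J₂′] / v[I₂′]) ∎
  where
  s : ℕ
  s = sup u
  u[I₁] u[J₁] v[I₂′] v[J₂′] : Word
  u[I₁] = u [ I₁ ]
  u[J₁] = u [ J₁ ]
  v[I₂′] = v [ shiftDown (length u) I₂ ]
  v[J₂′] = v [ shiftDown (length u) J₂ ]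
  -- the covering hypotheses place I₁, J₁ inside u and I₂, J₂ inside v
  inU : ∀ {K : IndexSet} → (∀ {k} → K k ≡ true → I₁ k ≡ true ⊎ J₁ k ≡ true) → ∀ k → K k ≡ true → k ≤ length u
  inU toCover k k∈K = proj₂ (Equivalence.to (cover₁ k) (toCover k∈K))
  inV : ∀ {K : IndexSet} → (∀ {k} → K k ≡ true → I₂ k ≡ true ⊎ J₂ k ≡ true) → ∀ k → K k ≡ true → length u + 1 ≤ k
  inV toCover k k∈K = proj₁ (Equivalence.to (cover₂ k) (toCover k∈K))
  ≤s : ∀ (K : IndexSet) → All (_≤ s) (u [ K ])
  ≤s K = restrict-All 1 u K (≤-sup u)
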